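{- Let $S=\{0=s_0<s_1<\dots<s_n\}$ be a finite set of nonnegative reals and let $x,y\in S\setminus\{0\}$. If $|x-y|\le s_1$ then $x\approx y$.
   Context: For $S=\{0=s_0<s_1<\dots<s_n\}$, $s_i$ is a jump number if $i=n$, or $i<n$ and $2s_i<s_{i+1}$ (so $s_0$ and $s_n$ are jump numbers). If $s_i<s_j$ are consecutive jump numbers, $S\cap(s_i,s_j]$ is a block of $S$; also $\{0\}$ is a block (the trivial block). The blocks partition $S$, and $x\approx y$ means $x$ and $y$ lie in the same block. -}

module Defs where

open import Level using (Level; suc; _⊔_)
open import Data.Nat as ℕ using (ℕ)
open import Data.Fin using (Fin; toℕ; zero; suc)
import Data.Fin
open import Data.Product using (Σ; ∃; ∃-syntax; _×_; _,_)
open import Data.Sum using (_⊎_)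
open import Relation.Binary.PropositionalEquality using (_≡_)
open import Relation.Binary.Definitions using (Trichotomous; Tri; tri<; tri≈; tri>)
open import Relation.Nullary using (¬_)

-- The real numbers (ℝ, 0, +, -, <) are an instance; agda-stdlib has no reals,
-- so the statement is made for every such structure.
record LinOrdAbGroup (a ℓ : Level) : Set (Level.suc (a ⊔ ℓ)) where
  infixl 6 _+_ _-_
  infix 4 _<_ _≤_
  field
    Carrier   : Set a
    0#        : Carrier
    _+_       : Carrier → Carrier → Carrier
    -_        : Carrier → Carrier
    _<_       : Carrier → Carrier → Set ℓ
    +-assoc   : ∀ x y z → (x + y) + z ≡ x + (y + z)
    +-comm    : ∀ x y → x + y ≡ y + x
    +-identityˡ : ∀ x → 0# + x ≡ x
    -‿inverseˡ  : ∀ x → (- x) + x ≡ 0#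
    <-irrefl  : ∀ x → ¬ (x < x)
    <-trans   : ∀ {x y z} → x < y → y < z → x < z
    <-compare : Trichotomous _≡_ _<_
    +-monoˡ-< : ∀ {x y} z → x < y → x + z < y + z

  _-_ : Carrier → Carrier → Carrier
  x - y = x + (- y)

  _≤_ : Carrier → Carrier → Set (a ⊔ ℓ)
  x ≤ y = (x < y) ⊎ (x ≡ y)

  ∣_∣ : Carrier → Carrier
  ∣ x ∣ with <-compare 0# x
  ... | tri< _ _ _ = x
  ... | tri≈ _ _ _ = x
  ... | tri> _ _ _ = - x

module Blocks {a ℓ} (G : LinOrdAbGroup a ℓ) where
  open LinOrdAbGroup G

  -- A finite set S = {0 = s_0 < s_1 < ... < s_n} is given by its increasing
  -- enumeration s : Fin (suc n) → Carrier.
  StrictlyIncreasing : ∀ {n} → (Fin n → Carrier) → Set ℓ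
  StrictlyIncreasing s = ∀ i j → i Data.Fin.< j → s i < s j

  IsJump : ∀ n → (Fin (ℕ.suc n) → Carrier) → Fin (ℕ.suc n) → Set ℓ
  IsJump n s i =
    (toℕ i ≡ n) ⊎
    (Σ (Fin (ℕ.suc n)) λ j → (toℕ j ≡ ℕ.suc (toℕ i)) × (s i + s i < s j))

  _∈S_ : ∀ {n} → Carrier → (Fin (ℕ.suc n) → Carrier) → Set a
  x ∈S s = ∃[ k ] (s k ≡ x)

  -- x ≈ y : x and y lie in the same block of S. Blocks are {0} (trivial
  -- block) and S ∩ (s_i, s_j] for consecutive jump numbers s_i < s_j.
  SameBlock : ∀ n → (Fin (ℕ.suc n) → Carrier) → Carrier → Carrier → Set (a ⊔ ℓ)
  SameBlock n s x y =
    ((x ≡ 0#) × (y ≡ 0#)) ⊎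
    (Σ (Fin (ℕ.suc n)) λ i → Σ (Fin (ℕ.suc n)) λ j →
        i Data.Fin.< j × IsJump n s i × IsJump n s j ×
        (∀ k → i Data.Fin.< k → k Data.Fin.< j → ¬ IsJump n s k) ×
        (x ∈S s) × (y ∈S s) ×
        (s i < x) × (x ≤ s j) × (s i < y) × (y ≤ s j))

-- Let u ≤ v be positive indices with s_v ≤ s_1 + s_u. A jump index k with u ≤ k < v is
-- impossible: it would give s_1 + s_u ≤ 2 s_k < s_{k+1} ≤ s_v. So s_u and s_v lie between
-- the last jump index below u (0 is one, as 2 s_0 = 0 < s_1) and the first jump index at or
-- above u (n is one), i.e. in one block.
module Submission where

open import Defs
open import Level using (Level)
open import Data.Nat using (ℕ; suc)
open import Data.Fin using (Fin; zero; suc)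
open import Relation.Binary.PropositionalEquality using (_≡_)
open import Relation.Nullary using (¬_)

open import Algebra.Bundles using (AbelianGroup)
import Algebra.Properties.AbelianGroup as AbelianGroupProperties
import Data.Nat as ℕ
import Data.Nat.Properties as ℕ
open import Data.Fin using (toℕ; fromℕ; lower₁)
open import Data.Fin.Properties
  using (any?; _<?_; _≤?_; ≤-total; ≤fromℕ; toℕ-injective; toℕ-fromℕ; toℕ-lower₁; toℕ≤pred[n])
open import Data.Product using (∃; ∃-syntax; _×_; _,_)
open import Data.Sum using (inj₁; inj₂; [_,_]′)
open import Function using (_∘_)
open import Relation.Binary.Definitions using (Decidable; tri<; tri≈; tri>)
open import Relation.Binary.Consequences using (tri⇒dec<)
open import Relation.Binary.PropositionalEquality
  using (refl; sym; trans; cong; cong₂; subst; subst₂; isEquivalence)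
open import Relation.Nullary using (yes; no; contradiction)
open import Relation.Nullary.Decidable using (map′; _×-dec_)
open import Relation.Unary using (Pred)
import Relation.Unary as U

module FinSearch where
  open Data.Fin using (_<_)

  ∃-least : ∀ {n p} {P : Pred (Fin n) p} → U.Decidable P → ∃ P →
            ∃[ j ] P j × (∀ k → k < j → ¬ P k)
  ∃-least {suc n} P? (w , Pw) with P? zero | w | Pw
  ... | yes P0 | _      | _   = zero , P0 , λ _ ()
  ... | no ¬P0 | zero   | P0  = contradiction P0 ¬P0
  ... | no ¬P0 | suc w′ | Pw′ with ∃-least (P? ∘ suc) (w′ , Pw′)
  ...   | j , Pj , below-j = suc j , Pj , below
    where
    below : ∀ k → k < suc j → ¬ _
    below zero    _           = ¬P0
    below (suc k) (ℕ.s≤s k<j) = below-j k k<j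

  ∃-greatest : ∀ {n p} {P : Pred (Fin n) p} → U.Decidable P → ∃ P →
               ∃[ i ] P i × (∀ k → i < k → ¬ P k)
  ∃-greatest {suc n} P? (w , Pw) with any? (P? ∘ suc) | w | Pw
  ... | no ¬∃P∘suc | zero   | P0  = zero , P0 , above
    where
    above : ∀ k → zero {n} < k → ¬ _
    above (suc k) _ Pk = ¬∃P∘suc (k , Pk)
  ... | no ¬∃P∘suc | suc w′ | Pw′ = contradiction (w′ , Pw′) ¬∃P∘suc
  ... | yes ∃P∘suc | _      | _   with ∃-greatest (P? ∘ suc) ∃P∘suc
  ...   | i , Pi , above-i = suc i , Pi , above
    where
    above : ∀ k → suc i < k → ¬ _
    above (suc k) (ℕ.s≤s i<k) = above-i k i<k

module LinOrdAbGroupProperties {a ℓ} (G : LinOrdAbGroup a ℓ) where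
  open LinOrdAbGroup G

  abelianGroup : AbelianGroup a a
  abelianGroup = record
    { Carrier = Carrier ; _≈_ = _≡_ ; _∙_ = _+_ ; ε = 0# ; _⁻¹ = -_
    ; isAbelianGroup = record
      { isGroup = record
        { isMonoid = record
          { isSemigroup = record
            { isMagma = record { isEquivalence = isEquivalence ; ∙-cong = cong₂ _+_ }
            ; assoc = +-assoc
            }
          ; identity = +-identityˡ , λ x → trans (+-comm x 0#) (+-identityˡ x)
          }
        ; inverse = -‿inverseˡ , λ x → trans (+-comm x (- x)) (-‿inverseˡ x)
        ; ⁻¹-cong = cong (λ x → - x)
        }
      ; comm = +-comm
      }
    }

  open AbelianGroup abelianGroup using (inverseʳ)
  open AbelianGroupProperties abelianGroup using (ε⁻¹≈ε; ⁻¹-anti-homo‿-; //-rightDividesˡ)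

  <-dec : Decidable _<_
  <-dec = tri⇒dec< <-compare

  <-≤-trans : ∀ {x y z} → x < y → y ≤ z → x < z
  <-≤-trans x<y (inj₁ y<z) = <-trans x<y y<z
  <-≤-trans x<y (inj₂ refl) = x<y

  ≤-<-trans : ∀ {x y z} → x ≤ y → y < z → x < z
  ≤-<-trans (inj₁ x<y) y<z = <-trans x<y y<z
  ≤-<-trans (inj₂ refl) y<z = y<z

  ≤-trans : ∀ {x y z} → x ≤ y → y ≤ z → x ≤ z
  ≤-trans (inj₁ x<y) y≤z = inj₁ (<-≤-trans x<y y≤z)
  ≤-trans (inj₂ refl) y≤z = y≤z

  +-monoʳ-< : ∀ {x y} z → x < y → z + x < z + y
  +-monoʳ-< {x} {y} z x<y = subst₂ _<_ (+-comm x z) (+-comm y z) (+-monoˡ-< z x<y)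

  +-mono-≤ : ∀ {x y u v} → x ≤ y → u ≤ v → x + u ≤ y + v
  +-mono-≤ (inj₁ x<y) (inj₁ u<v) = inj₁ (<-trans (+-monoˡ-< _ x<y) (+-monoʳ-< _ u<v))
  +-mono-≤ (inj₁ x<y) (inj₂ refl) = inj₁ (+-monoˡ-< _ x<y)
  +-mono-≤ (inj₂ refl) (inj₁ u<v) = inj₁ (+-monoʳ-< _ u<v)
  +-mono-≤ (inj₂ refl) (inj₂ refl) = inj₂ refl

  x>0⇒-x<0 : ∀ {x} → 0# < x → - x < 0#
  x>0⇒-x<0 {x} 0<x = subst₂ _<_ (+-identityˡ (- x)) (inverseʳ x) (+-monoˡ-< (- x) 0<x)

  x<0⇒-x>0 : ∀ {x} → x < 0# → 0# < - x
  x<0⇒-x>0 {x} x<0 = subst₂ _<_ (inverseʳ x) (+-identityˡ (- x)) (+-monoˡ-< (- x) x<0)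

  x≤∣x∣ : ∀ x → x ≤ ∣ x ∣
  x≤∣x∣ x with <-compare 0# x
  ... | tri< _ _ _   = inj₂ refl
  ... | tri≈ _ _ _   = inj₂ refl
  ... | tri> _ _ x<0 = inj₁ (<-trans x<0 (x<0⇒-x>0 x<0))

  -x≤∣x∣ : ∀ x → - x ≤ ∣ x ∣
  -x≤∣x∣ x with <-compare 0# x
  ... | tri< 0<x _ _ = inj₁ (<-trans (x>0⇒-x<0 0<x) 0<x)
  ... | tri≈ _ refl _ = inj₂ ε⁻¹≈ε
  ... | tri> _ _ _   = inj₂ refl

  x-y≤z⇒x≤z+y : ∀ {x y z} → x - y ≤ z → x ≤ z + y
  x-y≤z⇒x≤z+y {x} {y} {z} x-y≤z =
    subst (_≤ z + y) (//-rightDividesˡ y x) (+-mono-≤ x-y≤z (inj₂ refl))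

  ∣x-y∣≤z⇒x≤z+y : ∀ {x y z} → ∣ x - y ∣ ≤ z → x ≤ z + y
  ∣x-y∣≤z⇒x≤z+y {x} {y} ∣x-y∣≤z = x-y≤z⇒x≤z+y (≤-trans (x≤∣x∣ (x - y)) ∣x-y∣≤z)

  ∣x-y∣≤z⇒y≤z+x : ∀ {x y z} → ∣ x - y ∣ ≤ z → y ≤ z + x
  ∣x-y∣≤z⇒y≤z+x {x} {y} ∣x-y∣≤z =
    x-y≤z⇒x≤z+y (≤-trans (subst (_≤ ∣ x - y ∣) (⁻¹-anti-homo‿- x y) (-x≤∣x∣ (x - y))) ∣x-y∣≤z)

module BlockProperties {a ℓ} (G : LinOrdAbGroup a ℓ) where
  open LinOrdAbGroup G renaming (_<_ to _<ᴳ_; _≤_ to _≤ᴳ_)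
  open Blocks G
  open LinOrdAbGroupProperties G
  open Data.Fin using (_<_; _≤_)
  open FinSearch

  isJump? : ∀ {n} (s : Fin (suc n) → Carrier) → U.Decidable (IsJump n s)
  isJump? {n} s i with toℕ i ℕ.≟ n
  ... | yes i≡n = yes (inj₁ i≡n)
  ... | no i≢n =
    map′ (λ 2sᵢ<sᵢ₊₁ → inj₂ (i⁺ , toℕ-i⁺ , 2sᵢ<sᵢ₊₁)) at-successor (<-dec (s i + s i) (s i⁺))
    where
    i⁺ : Fin (suc n)
    i⁺ = suc (lower₁ i (i≢n ∘ sym))
    toℕ-i⁺ : toℕ i⁺ ≡ suc (toℕ i)
    toℕ-i⁺ = cong suc (toℕ-lower₁ i (i≢n ∘ sym))
    at-successor : IsJump n s i → s i + s i <ᴳ s i⁺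
    at-successor (inj₁ i≡n) = contradiction i≡n i≢n
    at-successor (inj₂ (j , toℕ-j , 2sᵢ<sⱼ)) =
      subst (λ k → s i + s i <ᴳ s k) (toℕ-injective (trans toℕ-j (sym toℕ-i⁺))) 2sᵢ<sⱼ

  last-isJump : ∀ {n} (s : Fin (suc n) → Carrier) → IsJump n s (fromℕ n)
  last-isJump {n} s = inj₁ (toℕ-fromℕ n)

  SameBlock-sym : ∀ {n s x y} → SameBlock n s x y → SameBlock n s y x
  SameBlock-sym (inj₁ (x≡0 , y≡0)) = inj₁ (y≡0 , x≡0)
  SameBlock-sym (inj₂ (i , j , i<j , Jᵢ , Jⱼ , between , x∈s , y∈s , sᵢ<x , x≤sⱼ , sᵢ<y , y≤sⱼ)) =
    inj₂ (i , j , i<j , Jᵢ , Jⱼ , between , y∈s , x∈s , sᵢ<y , y≤sⱼ , sᵢ<x , x≤sⱼ)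

  module Increasing {m} (s : Fin (suc (suc m)) → Carrier) (s-inc : StrictlyIncreasing s) where
    private
      n : ℕ
      n = suc m
      s₁ : Carrier
      s₁ = s (suc zero)

    s-mono-≤ : ∀ {i j} → i ≤ j → s i ≤ᴳ s j
    s-mono-≤ {i} {j} i≤j with ℕ.m≤n⇒m<n∨m≡n i≤j
    ... | inj₁ i<j = inj₁ (s-inc i j i<j)
    ... | inj₂ i≡j = inj₂ (cong s (toℕ-injective i≡j))

    zero-isJump : s zero ≡ 0# → IsJump n s zero
    zero-isJump s₀≡0 = inj₂ (suc zero , refl , subst (_<ᴳ s₁) s₀≡2s₀ (s-inc zero (suc zero) ℕ.z<s))
      where
      s₀≡2s₀ : s zero ≡ s zero + s zero
      s₀≡2s₀ = trans s₀≡0 (sym (trans (cong₂ _+_ s₀≡0 s₀≡0) (+-identityˡ 0#)))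

    JumpFree : Fin (suc n) → Fin (suc n) → Set ℓ
    JumpFree u v = ∀ k → u ≤ k → k < v → ¬ IsJump n s k

    close⇒jumpFree : ∀ {u v} → 0 ℕ.< toℕ u → s v ≤ᴳ s₁ + s u → JumpFree u v
    close⇒jumpFree {v = v} _ _ k _ k<v (inj₁ k≡n) =
      ℕ.<⇒≱ k<v (subst (toℕ v ℕ.≤_) (sym k≡n) (toℕ≤pred[n] v))
    close⇒jumpFree {u} {v} 0<u sᵥ≤s₁+sᵤ k u≤k k<v (inj₂ (k⁺ , toℕ-k⁺ , 2sₖ<sₖ₊₁)) =
      <-irrefl (s₁ + s u) (≤-<-trans s₁+sᵤ≤2sₖ (<-≤-trans 2sₖ<sₖ₊₁ (≤-trans sₖ₊₁≤sᵥ sᵥ≤s₁+sᵤ)))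
      where
      s₁+sᵤ≤2sₖ : s₁ + s u ≤ᴳ s k + s k
      s₁+sᵤ≤2sₖ = +-mono-≤ (s-mono-≤ {suc zero} {k} (ℕ.≤-trans 0<u u≤k)) (s-mono-≤ u≤k)
      sₖ₊₁≤sᵥ : s k⁺ ≤ᴳ s v
      sₖ₊₁≤sᵥ = s-mono-≤ {k⁺} {v} (subst (ℕ._≤ toℕ v) (sym toℕ-k⁺) k<v)

    jumpFree⇒sameBlock : s zero ≡ 0# → ∀ {u v} → 0 ℕ.< toℕ u → u ≤ v → JumpFree u v →
                         SameBlock n s (s u) (s v)
    jumpFree⇒sameBlock s₀≡0 {u} {v} 0<u u≤v gap
      with ∃-greatest (λ k → k <? u ×-dec isJump? s k) (zero , 0<u , zero-isJump s₀≡0)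
         | ∃-least (λ k → u ≤? k ×-dec isJump? s k) (fromℕ n , ≤fromℕ u , last-isJump s)
    ... | i , (i<u , Jᵢ) , above-i | j , (u≤j , Jⱼ) , below-j =
      inj₂ (i , j , ℕ.<-≤-trans i<u u≤j , Jᵢ , Jⱼ , between , (u , refl) , (v , refl)
           , s-inc i u i<u , s-mono-≤ u≤j , s-inc i v (ℕ.<-≤-trans i<u u≤v) , s-mono-≤ v≤j)
      where
      v≤j : v ≤ j
      v≤j = ℕ.≮⇒≥ λ j<v → gap j u≤j j<v Jⱼ
      between : ∀ k → i < k → k < j → ¬ IsJump n s k
      between k i<k k<j Jₖ with k <? u
      ... | yes k<u = above-i k i<k (k<u , Jₖ)
      ... | no k≮u  = below-j k k<j (ℕ.≮⇒≥ k≮u , Jₖ)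

    positive-index : s zero ≡ 0# → ∀ u → ¬ (s u ≡ 0#) → 0 ℕ.< toℕ u
    positive-index s₀≡0 zero    sᵤ≢0 = contradiction s₀≡0 sᵤ≢0
    positive-index s₀≡0 (suc u) _    = ℕ.z<s

lemma5p1 : ∀ {a ℓ} (G : LinOrdAbGroup a ℓ) →
    let open LinOrdAbGroup G
        open Blocks G
    in
    (m : ℕ) (s : Fin (suc (suc m)) → Carrier) →
    StrictlyIncreasing s → s zero ≡ 0# →
    (x y : Carrier) → x ∈S s → ¬ (x ≡ 0#) → y ∈S s → ¬ (y ≡ 0#) →
    ∣ x - y ∣ ≤ s (suc zero) →
    SameBlock (suc m) s x y
lemma5p1 G m s s-inc s₀≡0 x y (u , refl) x≢0 (v , refl) y≢0 ∣x-y∣≤s₁ =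
  [ (λ u≤v → jumpFree⇒sameBlock s₀≡0 0<u u≤v (close⇒jumpFree 0<u (∣x-y∣≤z⇒y≤z+x ∣x-y∣≤s₁)))
  , (λ v≤u → SameBlock-sym
      (jumpFree⇒sameBlock s₀≡0 0<v v≤u (close⇒jumpFree 0<v (∣x-y∣≤z⇒x≤z+y ∣x-y∣≤s₁))))
  ]′ (≤-total u v)
  where
  open LinOrdAbGroupProperties G
  open BlockProperties G
  open Increasing s s-inc
  0<u : 0 ℕ.< toℕ u
  0<u = positive-index s₀≡0 u x≢0
  0<v : 0 ℕ.< toℕ v
  0<v = positive-index s₀≡0 v y≢0
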